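{- Let $G$ be a finite group of order at least two, and let $x,y$ be distinct elements of $G$. Then $N(x)=N(y)$ if and only if both $x$ and $y$ are maximal involutions of $G$.
   Context: $N(x)$ denotes the open neighbourhood of $x$ in the power graph $\mathcal P_G$ (vertex set $G$, distinct elements adjacent iff one is a power of the other), i.e. the set of vertices adjacent to $x$. A maximal involution of $G$ is an element $x$ of order $2$ such that $\langle x\rangle$ is a maximal cyclic subgroup of $G$ (not properly contained in any cyclic subgroup of $G$). -}

module Defs where

open import Level using (Level; _⊔_)
open import Algebra.Bundles using (Group)
open import Data.Nat using (ℕ; zero; suc; _≤_)
open import Data.Integer using (ℤ; +_; -[1+_])
open import Data.Fin using (Fin)
open import Data.Product using (Σ; ∃; _×_)
open import Data.Sum using (_⊎_)
open import Relation.Nullary using (¬_)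
open import Function.Bundles using (Inverse)
open import Relation.Binary.PropositionalEquality using (setoid)

module PowerGraph {c ℓ : Level} (G : Group c ℓ) where
  open Group G

  _^ℕ_ : Carrier → ℕ → Carrier
  x ^ℕ zero  = ε
  x ^ℕ suc n = x ∙ (x ^ℕ n)

  _^ℤ_ : Carrier → ℤ → Carrier
  x ^ℤ (+ n)     = x ^ℕ n
  x ^ℤ -[1+ n ]  = (x ^ℕ suc n) ⁻¹

  IsPowerOf : Carrier → Carrier → Set ℓ
  IsPowerOf y x = ∃ λ (m : ℤ) → y ≈ (x ^ℤ m)

  Adj : Carrier → Carrier → Set ℓ
  Adj x y = (¬ x ≈ y) × (IsPowerOf y x ⊎ IsPowerOf x y)

  SameNbhd : Carrier → Carrier → Set (c ⊔ ℓ)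
  SameNbhd x y = ∀ z → (Adj x z → Adj y z) × (Adj y z → Adj x z)

  IsInvolution : Carrier → Set ℓ
  IsInvolution x = (¬ x ≈ ε) × ((x ∙ x) ≈ ε)

  -- <x> is a maximal cyclic subgroup: whenever <x> ⊆ <g>, <g> = <x>
  MaximalCyclic : Carrier → Set (c ⊔ ℓ)
  MaximalCyclic x = ∀ g → IsPowerOf x g → IsPowerOf g x

  IsMaximalInvolution : Carrier → Set (c ⊔ ℓ)
  IsMaximalInvolution x = IsInvolution x × MaximalCyclic x

FiniteOfOrder : {c ℓ : Level} → Group c ℓ → ℕ → Set _
FiniteOfOrder G n = Inverse (setoid (Fin n)) (Group.setoid G)

-- If N(x) = N(y) with x ≠ y, then x and y are not adjacent, so x⁻¹ (adjacent to x
-- unless x⁻¹ = x) forces x² = 1; and any g with x ∈ ⟨g⟩, g ≠ x, lies in N(y), so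
-- either g ∈ ⟨y⟩ = {1, y} or x and y are two involutions of the cyclic group ⟨g⟩,
-- which has at most one. Conversely a maximal involution x has N(x) = {1}.
module Submission where

open import Defs
open import Level using (Level)
open import Algebra.Bundles using (Group)
open import Data.Nat using (ℕ; _≤_)
open import Data.Product using (_×_)
open import Relation.Nullary using (¬_)
open import Function.Bundles using (_⇔_)

open import Data.Nat using (zero; suc; _+_; _*_; _<_; s≤s; z≤n)
open import Data.Nat.Properties using (+-comm; *-comm; m<m*n)
open import Data.Nat.Induction using (<-wellFounded)
open import Induction.WellFounded using (Acc; acc)
open import Data.Integer using (+_; -[1+_])
open import Data.Product using (∃; _,_; proj₁; proj₂)
open import Data.Sum using (_⊎_; inj₁; inj₂; [_,_]′)
open import Data.Empty using (⊥-elim)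
import Data.Fin.Properties as Fin
open import Function.Base using (id)
open import Function.Bundles using (mk⇔)
open import Function.Properties.Inverse using (Inverse⇒Injection)
import Function.Construct.Symmetry as Symmetry
open import Relation.Nullary using (yes; no)
open import Relation.Nullary.Decidable using (via-injection)
open import Relation.Binary.Definitions using (Decidable)
open import Relation.Binary.PropositionalEquality as ≡ using (_≡_)
import Algebra.Properties.Group as GroupProperties
import Algebra.Properties.Monoid.Mult as MonoidMult

data Parity : ℕ → Set where
  even : ∀ q → Parity (q * 2)
  odd  : ∀ q → Parity (suc (q * 2))

parity : ∀ n → Parity n
parity zero = even 0
parity (suc n) with parity n
... | even q = odd q
... | odd q  = even (suc q)

module PowerGraphProperties {c ℓ} (G : Group c ℓ) where
  open Group G
  open PowerGraph G
  open GroupProperties G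
  open MonoidMult monoid using (×-congʳ; ×-homo-+; ×-assocˡ) renaming (_×_ to _·_)
  open import Relation.Binary.Properties.Setoid setoid using (≉-sym)
  open import Relation.Binary.Reasoning.Setoid setoid

  ^ℕ≡· : ∀ x n → x ^ℕ n ≡ n · x
  ^ℕ≡· x zero    = ≡.refl
  ^ℕ≡· x (suc n) = ≡.cong (x ∙_) (^ℕ≡· x n)

  ^ℕ-congˡ : ∀ {x y} n → x ≈ y → x ^ℕ n ≈ y ^ℕ n
  ^ℕ-congˡ {x} {y} n x≈y rewrite ^ℕ≡· x n | ^ℕ≡· y n = ×-congʳ n x≈y

  ^ℕ-assocʳ : ∀ x m n → (x ^ℕ n) ^ℕ m ≈ x ^ℕ (m * n)
  ^ℕ-assocʳ x m n rewrite ^ℕ≡· x n | ^ℕ≡· (n · x) m | ^ℕ≡· x (m * n) = ×-assocˡ x m n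

  ^ℕ-cross : ∀ {g x y} a b → x ≈ g ^ℕ a → y ≈ g ^ℕ b → x ^ℕ b ≈ y ^ℕ a
  ^ℕ-cross {g} {x} {y} a b x≈gᵃ y≈gᵇ = begin
    x ^ℕ b         ≈⟨ ^ℕ-congˡ b x≈gᵃ ⟩
    (g ^ℕ a) ^ℕ b  ≈⟨ ^ℕ-assocʳ g b a ⟩
    g ^ℕ (b * a)   ≡⟨ ≡.cong (g ^ℕ_) (*-comm b a) ⟩
    g ^ℕ (a * b)   ≈⟨ ^ℕ-assocʳ g a b ⟨
    (g ^ℕ b) ^ℕ a  ≈⟨ ^ℕ-congˡ a y≈gᵇ ⟨
    y ^ℕ a         ∎

  ^ℕ-commutes : ∀ x n → x ^ℕ n ∙ x ≈ x ∙ x ^ℕ n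
  ^ℕ-commutes x n rewrite ^ℕ≡· x n = begin
    n · x ∙ x          ≈⟨ ∙-congˡ (identityʳ x) ⟨
    n · x ∙ 1 · x      ≈⟨ ×-homo-+ x n 1 ⟨
    (n + 1) · x        ≡⟨ ≡.cong (_· x) (+-comm n 1) ⟩
    suc n · x          ∎

  ⁻¹-^ℕ : ∀ x n → (x ⁻¹) ^ℕ n ≈ (x ^ℕ n) ⁻¹
  ⁻¹-^ℕ x zero    = sym ε⁻¹≈ε
  ⁻¹-^ℕ x (suc n) = begin
    x ⁻¹ ∙ (x ⁻¹) ^ℕ n  ≈⟨ ∙-congˡ (⁻¹-^ℕ x n) ⟩
    x ⁻¹ ∙ (x ^ℕ n) ⁻¹  ≈⟨ ⁻¹-anti-homo-∙ (x ^ℕ n) x ⟨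
    (x ^ℕ n ∙ x) ⁻¹     ≈⟨ ⁻¹-cong (^ℕ-commutes x n) ⟩
    (x ∙ x ^ℕ n) ⁻¹     ∎

  ^ℤ-congˡ : ∀ {x y} m → x ≈ y → x ^ℤ m ≈ y ^ℤ m
  ^ℤ-congˡ (+ n)    x≈y = ^ℕ-congˡ n x≈y
  ^ℤ-congˡ -[1+ n ] x≈y = ⁻¹-cong (^ℕ-congˡ (suc n) x≈y)

  ⁻¹-^ℤ : ∀ x m → (x ⁻¹) ^ℤ m ≈ (x ^ℤ m) ⁻¹
  ⁻¹-^ℤ x (+ n)    = ⁻¹-^ℕ x n
  ⁻¹-^ℤ x -[1+ n ] = ⁻¹-cong (⁻¹-^ℕ x (suc n))

  IsPowerOf-refl : ∀ {x} → IsPowerOf x x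
  IsPowerOf-refl {x} = + 1 , sym (identityʳ x)

  IsPowerOf-⁻¹ : ∀ {z x} → IsPowerOf z x → IsPowerOf (z ⁻¹) x
  IsPowerOf-⁻¹ (+ zero , z≈ε)     = + 0 , trans (⁻¹-cong z≈ε) ε⁻¹≈ε
  IsPowerOf-⁻¹ (+ suc n , z≈xⁿ)   = -[1+ n ] , ⁻¹-cong z≈xⁿ
  IsPowerOf-⁻¹ (-[1+ n ] , z≈x⁻ⁿ) = + suc n , trans (⁻¹-cong z≈x⁻ⁿ) (⁻¹-involutive _)

  IsPowerOf-respˡ : ∀ {z z′ x} → z ≈ z′ → IsPowerOf z′ x → IsPowerOf z x
  IsPowerOf-respˡ z≈z′ (m , z′≈xᵐ) = m , trans z≈z′ z′≈xᵐ

  IsPowerOf-base⁻¹ : ∀ {z x} → IsPowerOf z (x ⁻¹) → IsPowerOf z x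
  IsPowerOf-base⁻¹ {x = x} (m , z≈x⁻¹ᵐ) =
    IsPowerOf-respˡ (trans z≈x⁻¹ᵐ (⁻¹-^ℤ x m)) (IsPowerOf-⁻¹ (m , refl))

  IsPowerOf-respʳ : ∀ {z g h} → g ≈ h → IsPowerOf z g → IsPowerOf z h
  IsPowerOf-respʳ g≈h (m , z≈gᵐ) = m , trans z≈gᵐ (^ℤ-congˡ m g≈h)

  ^ℕ-even : ∀ {x} → x ∙ x ≈ ε → ∀ q → x ^ℕ (q * 2) ≈ ε
  ^ℕ-even x²≈ε zero    = refl
  ^ℕ-even x²≈ε (suc q) = trans (∙-congˡ (trans (∙-congˡ (^ℕ-even x²≈ε q)) (identityʳ _))) x²≈ε

  ^ℕ-odd : ∀ {x} → x ∙ x ≈ ε → ∀ q → x ^ℕ suc (q * 2) ≈ x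
  ^ℕ-odd x²≈ε q = trans (∙-congˡ (^ℕ-even x²≈ε q)) (identityʳ _)

  ^ℕ-of-involution : ∀ {x} → x ∙ x ≈ ε → ∀ n → x ^ℕ n ≈ ε ⊎ x ^ℕ n ≈ x
  ^ℕ-of-involution x²≈ε n with parity n
  ... | even q = inj₁ (^ℕ-even x²≈ε q)
  ... | odd q  = inj₂ (^ℕ-odd x²≈ε q)

  involution-⁻¹ : ∀ {x} → x ∙ x ≈ ε → x ⁻¹ ≈ x
  involution-⁻¹ {x} x²≈ε = sym (inverseʳ-unique x x x²≈ε)

  powers-of-involution : ∀ {z x} → x ∙ x ≈ ε → IsPowerOf z x → z ≈ ε ⊎ z ≈ x
  powers-of-involution x²≈ε (+ n , z≈xⁿ) with ^ℕ-of-involution x²≈ε n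
  ... | inj₁ xⁿ≈ε = inj₁ (trans z≈xⁿ xⁿ≈ε)
  ... | inj₂ xⁿ≈x = inj₂ (trans z≈xⁿ xⁿ≈x)
  powers-of-involution x²≈ε (-[1+ n ] , z≈x⁻ⁿ) with ^ℕ-of-involution x²≈ε (suc n)
  ... | inj₁ xⁿ≈ε = inj₁ (trans z≈x⁻ⁿ (trans (⁻¹-cong xⁿ≈ε) ε⁻¹≈ε))
  ... | inj₂ xⁿ≈x = inj₂ (trans z≈x⁻ⁿ (trans (⁻¹-cong xⁿ≈x) (involution-⁻¹ x²≈ε)))

  involution-natural-power : ∀ {x g} → x ∙ x ≈ ε → IsPowerOf x g → ∃ λ a → x ≈ g ^ℕ a
  involution-natural-power x²≈ε (+ n , x≈gⁿ) = n , x≈gⁿ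
  involution-natural-power {x} {g} x²≈ε (-[1+ n ] , x≈g⁻ⁿ) = suc n , (begin
    x                  ≈⟨ involution-⁻¹ x²≈ε ⟨
    x ⁻¹               ≈⟨ ⁻¹-cong x≈g⁻ⁿ ⟩
    (g ^ℕ suc n) ⁻¹ ⁻¹ ≈⟨ ⁻¹-involutive _ ⟩
    g ^ℕ suc n         ∎)

  -- Raising x = gᵃ to b and y = gᵇ to a gives xᵇ = yᵃ; comparing parities settles
  -- every case except a, b both even, where one passes from g to g².
  cyclic-involutions-coincide : ∀ {g x y} a b → IsInvolution x → IsInvolution y →
                                x ≈ g ^ℕ a → y ≈ g ^ℕ b → x ≈ y
  cyclic-involutions-coincide a = go a (<-wellFounded a)
    where
    go : ∀ {g x y} a → Acc _<_ a → ∀ b → IsInvolution x → IsInvolution y →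
         x ≈ g ^ℕ a → y ≈ g ^ℕ b → x ≈ y
    go {g} {x} {y} a (acc smaller) b (x≉ε , x²≈ε) (y≉ε , y²≈ε) x≈gᵃ y≈gᵇ
      with parity a | parity b | ^ℕ-cross a b x≈gᵃ y≈gᵇ
    ... | even zero    | _      | _ = ⊥-elim (x≉ε x≈gᵃ)
    ... | even (suc p) | even q | _ =
      go (suc p) (smaller (m<m*n (suc p) 2 (s≤s (s≤s z≤n)))) q (x≉ε , x²≈ε) (y≉ε , y²≈ε)
         (trans x≈gᵃ (sym (^ℕ-assocʳ g (suc p) 2)))
         (trans y≈gᵇ (sym (^ℕ-assocʳ g q 2)))
    ... | even p | odd q  | xᵇ≈yᵃ = ⊥-elim (x≉ε (trans (sym (^ℕ-odd x²≈ε q)) (trans xᵇ≈yᵃ (^ℕ-even y²≈ε p))))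
    ... | odd p  | even q | xᵇ≈yᵃ = ⊥-elim (y≉ε (trans (sym (^ℕ-odd y²≈ε p)) (trans (sym xᵇ≈yᵃ) (^ℕ-even x²≈ε q))))
    ... | odd p  | odd q  | xᵇ≈yᵃ = trans (sym (^ℕ-odd x²≈ε q)) (trans xᵇ≈yᵃ (^ℕ-odd y²≈ε p))

  SameNbhd-sym : ∀ {x y} → SameNbhd x y → SameNbhd y x
  SameNbhd-sym N z = proj₂ (N z) , proj₁ (N z)

  SameNbhd⇒unrelated : ∀ {x y} → x ≉ y → SameNbhd x y → ¬ IsPowerOf x y × ¬ IsPowerOf y x
  SameNbhd⇒unrelated {x} {y} x≉y N = (λ x∈⟨y⟩ → y≁x (≉-sym x≉y , inj₁ x∈⟨y⟩))
                                   , (λ y∈⟨x⟩ → y≁x (≉-sym x≉y , inj₂ y∈⟨x⟩))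
    where
    y≁x : ¬ Adj y x
    y≁x y∼x = proj₁ (proj₂ (N x) y∼x) refl

  adj-to-ε : ∀ {y z} → y ≉ ε → z ≈ ε → Adj y z
  adj-to-ε y≉ε z≈ε = (λ y≈z → y≉ε (trans y≈z z≈ε)) , inj₁ (+ 0 , z≈ε)

  MaximalInvolution-adj⇒ε : ∀ {x z} → IsMaximalInvolution x → Adj x z → z ≈ ε
  MaximalInvolution-adj⇒ε {x} {z} ((_ , x²≈ε) , maximal) (x≉z , related) =
    [ id , (λ z≈x → ⊥-elim (x≉z (sym z≈x))) ]′ (powers-of-involution x²≈ε z∈⟨x⟩)
    where
    z∈⟨x⟩ : IsPowerOf z x
    z∈⟨x⟩ = [ id , maximal z ]′ related

  MaximalInvolutions⇒SameNbhd : ∀ {x y} → IsMaximalInvolution x → IsMaximalInvolution y → SameNbhd x y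
  MaximalInvolutions⇒SameNbhd mx@((x≉ε , _) , _) my@((y≉ε , _) , _) z =
    (λ x∼z → adj-to-ε y≉ε (MaximalInvolution-adj⇒ε mx x∼z)) ,
    (λ y∼z → adj-to-ε x≉ε (MaximalInvolution-adj⇒ε my y∼z))

  module _ (_≟_ : Decidable _≈_) where

    SameNbhd⇒IsInvolution : ∀ {x y} → x ≉ y → SameNbhd x y → IsInvolution x
    SameNbhd⇒IsInvolution {x} {y} x≉y N = (λ x≈ε → x∉⟨y⟩ (+ 0 , x≈ε)) , x²≈ε
      where
      x∉⟨y⟩ : ¬ IsPowerOf x y
      x∉⟨y⟩ = proj₁ (SameNbhd⇒unrelated x≉y N)
      y∉⟨x⟩ : ¬ IsPowerOf y x
      y∉⟨x⟩ = proj₂ (SameNbhd⇒unrelated x≉y N)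
      x²≈ε : x ∙ x ≈ ε
      x²≈ε with (x ⁻¹) ≟ x
      ... | yes x⁻¹≈x = trans (∙-congˡ (sym x⁻¹≈x)) (inverseʳ x)
      ... | no x⁻¹≉x with proj₁ (N (x ⁻¹)) (≉-sym x⁻¹≉x , inj₁ (IsPowerOf-⁻¹ IsPowerOf-refl))
      ...   | _ , inj₁ x⁻¹∈⟨y⟩ = ⊥-elim (x∉⟨y⟩ (IsPowerOf-respˡ (sym (⁻¹-involutive x)) (IsPowerOf-⁻¹ x⁻¹∈⟨y⟩)))
      ...   | _ , inj₂ y∈⟨x⁻¹⟩ = ⊥-elim (y∉⟨x⟩ (IsPowerOf-base⁻¹ y∈⟨x⁻¹⟩))

    SameNbhd⇒MaximalCyclic : ∀ {x y} → x ≉ y → SameNbhd x y → MaximalCyclic x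
    SameNbhd⇒MaximalCyclic {x} {y} x≉y N =
      maximal (SameNbhd⇒IsInvolution x≉y N) (SameNbhd⇒IsInvolution (≉-sym x≉y) (SameNbhd-sym N))
      where
      x∉⟨y⟩ : ¬ IsPowerOf x y
      x∉⟨y⟩ = proj₁ (SameNbhd⇒unrelated x≉y N)
      maximal : IsInvolution x → IsInvolution y → MaximalCyclic x
      maximal ix@(x≉ε , x²≈ε) iy@(_ , y²≈ε) g x∈⟨g⟩ with g ≟ x
      ... | yes g≈x = IsPowerOf-respˡ g≈x IsPowerOf-refl
      ... | no g≉x with proj₁ (N g) (≉-sym g≉x , inj₂ x∈⟨g⟩)
      ...   | _ , inj₁ g∈⟨y⟩ = ⊥-elim ([ g≉ε , g≉y ]′ (powers-of-involution y²≈ε g∈⟨y⟩))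
        where
        -- ε is its own square root, so powers-of-involution also describes ⟨ε⟩ = {ε}.
        g≉ε : g ≉ ε
        g≉ε g≈ε = x≉ε ([ id , id ]′ (powers-of-involution (identityˡ ε) (IsPowerOf-respʳ g≈ε x∈⟨g⟩)))
        g≉y : g ≉ y
        g≉y g≈y = x∉⟨y⟩ (IsPowerOf-respʳ g≈y x∈⟨g⟩)
      ...   | _ , inj₂ y∈⟨g⟩ with involution-natural-power x²≈ε x∈⟨g⟩ | involution-natural-power y²≈ε y∈⟨g⟩
      ...     | a , x≈gᵃ | b , y≈gᵇ = ⊥-elim (x≉y (cyclic-involutions-coincide a b ix iy x≈gᵃ y≈gᵇ))

    SameNbhd⇒IsMaximalInvolution : ∀ {x y} → x ≉ y → SameNbhd x y → IsMaximalInvolution x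
    SameNbhd⇒IsMaximalInvolution x≉y N = SameNbhd⇒IsInvolution x≉y N , SameNbhd⇒MaximalCyclic x≉y N

    SameNbhd⇔MaximalInvolutions : ∀ {x y} → x ≉ y →
                                  SameNbhd x y ⇔ (IsMaximalInvolution x × IsMaximalInvolution y)
    SameNbhd⇔MaximalInvolutions x≉y = mk⇔
      (λ N → SameNbhd⇒IsMaximalInvolution x≉y N
           , SameNbhd⇒IsMaximalInvolution (≉-sym x≉y) (SameNbhd-sym N))
      (λ (mx , my) → MaximalInvolutions⇒SameNbhd mx my)

finite⇒decidable : ∀ {c ℓ} (G : Group c ℓ) n → FiniteOfOrder G n → Decidable (Group._≈_ G)
finite⇒decidable G n fin = via-injection (Inverse⇒Injection (Symmetry.inverse fin)) Fin._≟_

lemma3p2 : {c ℓ : Level} (G : Group c ℓ) (n : ℕ) → FiniteOfOrder G n → 2 ≤ n →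
    (x y : Group.Carrier G) → ¬ Group._≈_ G x y →
    PowerGraph.SameNbhd G x y ⇔ (PowerGraph.IsMaximalInvolution G x × PowerGraph.IsMaximalInvolution G y)
lemma3p2 G n fin _ x y =
  PowerGraphProperties.SameNbhd⇔MaximalInvolutions G (finite⇒decidable G n fin)
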